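{- Let $G$ be a graph over a vertex set $V$ that is not $m$-colorable, and let $\mathcal{G}=(G_1,\ldots,G_k)$ be a sequence of bipartite graphs, $G_i$ over vertex set $V_i\subseteq V$, with $G=\bigcup_{i=1}^k G_i$. Then $\mathrm{cap}(\mathcal{G})\ge (m+1)\log_2(m+1)$.
   Context: For a sequence $\mathcal{G}=(G_1,\ldots,G_k)$ of graphs with $G_i$ over vertex set $V_i$, its capacity is $\mathrm{cap}(\mathcal{G})=\sum_{i=1}^k|V_i|$. $G=\bigcup_i G_i$ means that the edge set of $G$ is the union of the edge sets of the $G_i$. -}

module Defs where

open import Level using (0ℓ)
open import Data.Nat using (ℕ; zero; suc; _+_; _^_; _≤_)
open import Data.Fin using (Fin; zero; suc)
open import Data.Fin.Subset using (Subset; _∈_; ∣_∣)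
open import Data.Bool using (Bool)
open import Data.Product using (Σ; ∃; _×_; _,_)
open import Relation.Binary.PropositionalEquality using (_≡_; _≢_)
open import Relation.Nullary using (¬_)

record Graph (n : ℕ) : Set₁ where
  field
    Adj : Fin n → Fin n → Set
    sym : ∀ {u v} → Adj u v → Adj v u
open Graph public

IsColoring : ∀ {n} → Graph n → (m : ℕ) → (Fin n → Fin m) → Set
IsColoring G m c = ∀ u v → Adj G u v → c u ≢ c v

Colorable : ∀ {n} → Graph n → ℕ → Set
Colorable {n} G m = Σ (Fin n → Fin m) (IsColoring G m)

record SubGraph (n : ℕ) : Set₁ where
  field
    verts : Subset n
    graph : Graph n
    inVerts : ∀ {u v} → Adj graph u v → (u ∈ verts) × (v ∈ verts)
open SubGraph public

-- Bipartite: there is a 2-colouring with every edge bichromatic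
-- (the values of the colouring outside V_i are irrelevant).
Bipartite : ∀ {n} → SubGraph n → Set
Bipartite H = Colorable (graph H) 2

IsUnion : ∀ {n k} → Graph n → (Fin k → SubGraph n) → Set
IsUnion {n} {k} G Gs =
  ∀ (u v : Fin n) → (Adj G u v → ∃ λ i → Adj (graph (Gs i)) u v)
                  × ((∃ λ i → Adj (graph (Gs i)) u v) → Adj G u v)

cap : ∀ {n} k → (Fin k → SubGraph n) → ℕ
cap zero    Gs = 0
cap (suc k) Gs = ∣ verts (Gs zero) ∣ + cap k (λ i → Gs (suc i))

-- Bipartition each Gᵢ by colᵢ and send a vertex v to the subcube of {0,1}ᵏ whose
-- i-th coordinate is fixed to colᵢ(v) when v ∈ Vᵢ and free otherwise. Its codimension
-- counts the Vᵢ containing v, so these codimensions add up to cap, and the cubes of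
-- adjacent vertices are disjoint. Replacing a cube by its intersection with a cube it
-- meets never increases the total codimension, and so produces t pairwise disjoint
-- cubes, one inside each vertex cube; colouring a vertex by such a cube is proper,
-- whence t > m. Finally, Kraft's inequality Σ 2^(k - codim) ≤ 2^k for disjoint cubes
-- and AM–GM give Σ codim ≥ t log₂ t, i.e. tᵗ ≤ 2^cap.
module Submission where

open import Defs hiding (sym)

open import Data.Nat
  using (ℕ; zero; suc; _+_; _*_; _^_; _≤_; _<_; z≤n; s≤s; NonZero; >-nonZero⁻¹)
open import Data.Nat.Properties hiding (_≟_)
open import Data.Nat.ListAction using (sum; product)
open import Data.Nat.Tactic.RingSolver using (solve-∀)
open import Data.List using (List; []; _∷_; length; map; filter; foldr; tabulate; lookup)
open import Data.List.Properties using (length-map; map-tabulate)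
open import Data.List.Relation.Unary.All using (All; []; _∷_)
import Data.List.Relation.Unary.All as All
open import Data.List.Relation.Unary.All.Properties using (tabulate⁻)
open import Data.List.Relation.Unary.AllPairs using (AllPairs; []; _∷_)
open import Data.List.Relation.Unary.Any using (Any; here; there)
import Data.List.Relation.Unary.Any as Any
open import Data.List.Relation.Unary.Any.Properties using (lookup-index)
open import Data.Fin using (Fin; zero; suc; inject≤)
open import Data.Fin.Patterns using (0F; 1F)
open import Data.Fin.Properties using (_≟_; any?; inject≤-injective)
open import Data.Fin.Subset using (Subset; _∈_; ∣_∣)
open import Data.Bool using (true; false; if_then_else_)
import Data.Vec as Vec
open import Data.Vec.Properties using ([]=⇒lookup)
open import Data.Maybe using (Maybe; just; nothing; _<∣>_)
open import Data.Vec.Functional using (Vector; head; tail)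
open import Algebra.Properties.CommutativeMonoid.Sum +-0-commutativeMonoid
  using (sum-syntax; ∑-distrib-+; ∑-comm; sum-cong-≗)
open import Data.Empty using (⊥; ⊥-elim)
open import Data.Product using (∃; _,_; proj₁; proj₂)
open import Data.Sum using (inj₁; inj₂)
open import Relation.Nullary using (¬_; Dec; yes; no; ¬?)
open import Relation.Binary.PropositionalEquality
open import Function using (_∘_)

^-distribʳ-* : ∀ a b n → (a * b) ^ n ≡ a ^ n * b ^ n
^-distribʳ-* a b zero    = refl
^-distribʳ-* a b (suc n) = begin
  a * b * (a * b) ^ n         ≡⟨ cong (a * b *_) (^-distribʳ-* a b n) ⟩
  a * b * (a ^ n * b ^ n)     ≡⟨ [m*n]*[o*p]≡[m*o]*[n*p] a b (a ^ n) (b ^ n) ⟩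
  a * a ^ n * (b * b ^ n)     ∎
  where open ≡-Reasoning

nⁿ-nonZero : ∀ n → NonZero (n ^ n)
nⁿ-nonZero zero    = _
nⁿ-nonZero (suc n) = m^n≢0 (suc n) (suc n)

m≤n⇒mᵐ≤nⁿ : ∀ {m n} → m ≤ n → m ^ m ≤ n ^ n
m≤n⇒mᵐ≤nⁿ {zero}  {n}     _   = >-nonZero⁻¹ (n ^ n) {{nⁿ-nonZero n}}
m≤n⇒mᵐ≤nⁿ {suc m} {suc n} m≤n =
  ≤-trans (^-monoˡ-≤ (suc m) m≤n) (^-monoʳ-≤ (suc n) m≤n)

2*m*n≤m*m+n*n-ordered : ∀ {m n} → m ≤ n → 2 * m * n ≤ m * m + n * n
2*m*n≤m*m+n*n-ordered {m} m≤n with m≤n⇒∃[o]m+o≡n m≤n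
... | d , refl = ≤-trans (m≤m+n (2 * m * (m + d)) (d * d)) (≤-reflexive (square-expansion m d))
  where
  square-expansion : ∀ m d → 2 * m * (m + d) + d * d ≡ m * m + (m + d) * (m + d)
  square-expansion = solve-∀

2*m*n≤m*m+n*n : ∀ m n → 2 * m * n ≤ m * m + n * n
2*m*n≤m*m+n*n m n with ≤-total m n
... | inj₁ m≤n = 2*m*n≤m*m+n*n-ordered m≤n
... | inj₂ n≤m = subst₂ _≤_ (e n m) (+-comm (n * n) (m * m)) (2*m*n≤m*m+n*n-ordered n≤m)
  where
  e : ∀ n m → 2 * n * m ≡ 2 * m * n
  e = solve-∀

weighted-amgm : ∀ n a b → suc n * a * b ^ n ≤ a ^ suc n + n * b ^ suc n
weighted-amgm zero    a b = ≤-reflexive (e₀ a b)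
  where
  e₀ : ∀ a b → 1 * a * 1 ≡ a * 1 + 0 * (b * 1)
  e₀ = solve-∀
weighted-amgm (suc n) a b = +-cancelˡ-≤ (n * a * (b * b ^ n)) _ _ (begin
  n * a * (b * b ^ n) + suc (suc n) * a * (b * b ^ n)
    ≡⟨ e₁ n a b (b ^ n) ⟩
  suc n * b ^ n * (2 * a * b)
    ≤⟨ *-monoʳ-≤ (suc n * b ^ n) (2*m*n≤m*m+n*n a b) ⟩
  suc n * b ^ n * (a * a + b * b)
    ≡⟨ e₂ n a b (b ^ n) ⟩
  a * (suc n * a * b ^ n) + suc n * (b * (b * b ^ n))
    ≤⟨ +-monoˡ-≤ _ (*-monoʳ-≤ a (weighted-amgm n a b)) ⟩
  a * (a ^ suc n + n * b ^ suc n) + suc n * (b * (b * b ^ n))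
    ≡⟨ e₃ n a b (b ^ n) (a ^ suc n) ⟩
  n * a * (b * b ^ n) + (a * a ^ suc n + suc n * (b * (b * b ^ n))) ∎)
  where
  open ≤-Reasoning
  e₁ : ∀ n a b w → n * a * (b * w) + suc (suc n) * a * (b * w) ≡ suc n * w * (2 * a * b)
  e₁ = solve-∀
  e₂ : ∀ n a b w → suc n * w * (a * a + b * b) ≡ a * (suc n * a * w) + suc n * (b * (b * w))
  e₂ = solve-∀
  e₃ : ∀ n a b w u → a * (u + n * (b * w)) + suc n * (b * (b * w))
                   ≡ n * a * (b * w) + (a * u + suc n * (b * (b * w)))
  e₃ = solve-∀

-- AM–GM for y and t copies of S / t, cleared of denominators.
amgm-step : ∀ t S y → suc t ^ suc t * y * S ^ t ≤ t ^ t * (S + y) ^ suc t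
amgm-step zero S y = begin
  1 * y * 1           ≡⟨ e₁ y ⟩
  y                   ≤⟨ m≤n+m y S ⟩
  S + y               ≡⟨ e₂ (S + y) ⟩
  1 * ((S + y) * 1)   ∎
  where
  open ≤-Reasoning
  e₁ : ∀ y → 1 * y * 1 ≡ y
  e₁ = solve-∀
  e₂ : ∀ x → x ≡ 1 * (x * 1)
  e₂ = solve-∀
amgm-step t@(suc _) S y = *-cancelˡ-≤ t (begin
  t * (suc t ^ suc t * y * S ^ t)     ≡⟨ e₁ t y (suc t ^ t) (S ^ t) ⟩
  t * suc t * y * (suc t ^ t * S ^ t) ≡⟨ cong (t * suc t * y *_) (^-distribʳ-* (suc t) S t) ⟨
  t * suc t * y * b ^ t               ≤⟨ +-cancelˡ-≤ (t * b ^ suc t) _ _ weighted ⟩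
  a ^ suc t                           ≡⟨ ^-distribʳ-* t (S + y) (suc t) ⟩
  t * t ^ t * (S + y) ^ suc t         ≡⟨ *-assoc t (t ^ t) _ ⟩
  t * (t ^ t * (S + y) ^ suc t)       ∎)
  where
  open ≤-Reasoning
  a b : ℕ
  a = t * (S + y)
  b = suc t * S
  e₁ : ∀ t y X Z → t * (suc t * X * y * Z) ≡ t * suc t * y * (X * Z)
  e₁ = solve-∀
  e₂ : ∀ t S y B → suc t * (t * (S + y)) * B ≡ t * (suc t * S * B) + t * suc t * y * B
  e₂ = solve-∀
  weighted : t * b ^ suc t + t * suc t * y * b ^ t ≤ t * b ^ suc t + a ^ suc t
  weighted = begin
    t * b ^ suc t + t * suc t * y * b ^ t ≡⟨ e₂ t S y (b ^ t) ⟨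
    suc t * a * b ^ t                     ≤⟨ weighted-amgm t a b ⟩
    a ^ suc t + t * b ^ suc t             ≡⟨ +-comm (a ^ suc t) _ ⟩
    t * b ^ suc t + a ^ suc t             ∎

amgm : ∀ xs → length xs ^ length xs * product xs ≤ sum xs ^ length xs
amgm []       = ≤-refl
amgm (y ∷ ys) = *-cancelˡ-≤ (t ^ t) {{nⁿ-nonZero t}} (begin
  t ^ t * (suc t ^ suc t * (y * P))   ≡⟨ e (t ^ t) (suc t ^ suc t) y P ⟩
  suc t ^ suc t * y * (t ^ t * P)     ≤⟨ *-monoʳ-≤ (suc t ^ suc t * y) (amgm ys) ⟩
  suc t ^ suc t * y * S ^ t           ≤⟨ amgm-step t S y ⟩
  t ^ t * (S + y) ^ suc t             ≡⟨ cong (λ z → t ^ t * z ^ suc t) (+-comm S y) ⟩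
  t ^ t * (y + S) ^ suc t             ∎)
  where
  open ≤-Reasoning
  t S P : ℕ
  t = length ys
  S = sum ys
  P = product ys
  e : ∀ T U y P → T * (U * (y * P)) ≡ U * y * (T * P)
  e = solve-∀

-- A subcube of {0,1}ᵏ: each coordinate is either free (nothing) or fixed to a bit.
Cube : ℕ → Set
Cube k = Vector (Maybe (Fin 2)) k

fixed : Maybe (Fin 2) → ℕ
fixed nothing  = 0
fixed (just _) = 1

codim : ∀ {k} → Cube k → ℕ
codim {k} c = ∑[ i < k ] fixed (c i)

freedom : Maybe (Fin 2) → ℕ
freedom nothing  = 2
freedom (just _) = 1

size : ∀ {k} → Cube k → ℕ
size {zero}  c = 1
size {suc k} c = freedom (head c) * size (tail c)

size*2^codim≡2^k : ∀ {k} (c : Cube k) → size c * 2 ^ codim c ≡ 2 ^ k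
size*2^codim≡2^k {zero}  c = refl
size*2^codim≡2^k {suc k} c with c zero
... | nothing = trans (*-assoc 2 (size (tail c)) _) (cong (2 *_) (size*2^codim≡2^k (tail c)))
... | just _  = trans (e (size (tail c)) (2 ^ codim (tail c))) (cong (2 *_) (size*2^codim≡2^k (tail c)))
  where
  e : ∀ s p → 1 * s * (2 * p) ≡ 2 * (s * p)
  e = solve-∀

Clash : Maybe (Fin 2) → Maybe (Fin 2) → Set
Clash (just a) (just b) = a ≢ b
Clash (just _) nothing  = ⊥
Clash nothing  _        = ⊥

clash? : ∀ x y → Dec (Clash x y)
clash? (just a) (just b) = ¬? (a ≟ b)
clash? (just _) nothing  = no λ ()
clash? nothing  _        = no λ ()

clash-sym : ∀ x y → Clash x y → Clash y x
clash-sym (just a) (just b) a≢b = a≢b ∘ sym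

Disjoint : ∀ {k} → Cube k → Cube k → Set
Disjoint c d = ∃ λ i → Clash (c i) (d i)

disjoint? : ∀ {k} (c d : Cube k) → Dec (Disjoint c d)
disjoint? c d = any? (λ i → clash? (c i) (d i))

Disjoint-sym : ∀ {k} {c d : Cube k} → Disjoint c d → Disjoint d c
Disjoint-sym {c = c} {d} (i , clash) = i , clash-sym (c i) (d i) clash

Disjoint-irrefl : ∀ {k} {c : Cube k} → ¬ Disjoint c c
Disjoint-irrefl {c = c} (i , clash) with c i
... | just a = clash refl

_⊆_ : ∀ {k} → Cube k → Cube k → Set
T ⊆ S = ∀ i {b} → S i ≡ just b → T i ≡ just b

⊆-refl : ∀ {k} {c : Cube k} → c ⊆ c
⊆-refl i eq = eq

⊆-trans : ∀ {k} {c d e : Cube k} → c ⊆ d → d ⊆ e → c ⊆ e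
⊆-trans c⊆d d⊆e i eq = c⊆d i (d⊆e i eq)

Disjoint-⊆ʳ : ∀ {k} {c d e : Cube k} → Disjoint c d → e ⊆ d → Disjoint c e
Disjoint-⊆ʳ {c = c} {d} {e} (i , clash) e⊆d = i , shrink (c i) (d i) clash (e⊆d i)
  where
  shrink : ∀ x y {z} → Clash x y → (∀ {b} → y ≡ just b → z ≡ just b) → Clash x z
  shrink (just a) (just b) a≢b z≼y rewrite z≼y refl = a≢b

-- The intersection of c and d when they are not disjoint; otherwise still a subcube of c.
_∩_ : ∀ {k} → Cube k → Cube k → Cube k
(c ∩ d) i = c i <∣> d i

∩-⊆ˡ : ∀ {k} (c d : Cube k) → (c ∩ d) ⊆ c
∩-⊆ˡ c d i eq rewrite eq = refl

∩-⊆ʳ : ∀ {k} {c d : Cube k} → ¬ Disjoint c d → (c ∩ d) ⊆ d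
∩-⊆ʳ {c = c} {d} ¬cd i {b} eq with c i in ci
... | nothing = eq
... | just a with a ≟ b
...   | yes refl = refl
...   | no a≢b   = ⊥-elim (¬cd (i , subst₂ Clash (sym ci) (sym eq) a≢b))

∑-mono-≤ : ∀ {n} {f g : Fin n → ℕ} →
           (∀ i → f i ≤ g i) → ∑[ i < n ] f i ≤ ∑[ i < n ] g i
∑-mono-≤ {zero}  f≤g = z≤n
∑-mono-≤ {suc n} f≤g = +-mono-≤ (f≤g zero) (∑-mono-≤ (f≤g ∘ suc))

codim-∩ : ∀ {k} (c d : Cube k) → codim (c ∩ d) ≤ codim c + codim d
codim-∩ c d = ≤-trans (∑-mono-≤ (λ i → fixed-<∣> (c i) (d i)))
                      (≤-reflexive (∑-distrib-+ (fixed ∘ c) (fixed ∘ d)))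
  where
  fixed-<∣> : ∀ x y → fixed (x <∣> y) ≤ fixed x + fixed y
  fixed-<∣> nothing  y = ≤-refl
  fixed-<∣> (just _) y = s≤s z≤n

data Admits (b : Fin 2) : Maybe (Fin 2) → Set where
  free : Admits b nothing
  same : Admits b (just b)

admits? : ∀ b x → Dec (Admits b x)
admits? b nothing  = yes free
admits? b (just a) with a ≟ b
... | yes refl = yes same
... | no a≢b   = no λ { same → a≢b refl }

admits-¬clash : ∀ {b x y} → Admits b x → Admits b y → ¬ Clash x y
admits-¬clash same same clash = clash refl

-- The cubes of L meeting the facet x₀ = b, as subcubes of that facet.
slice : ∀ {k} → Fin 2 → List (Cube (suc k)) → List (Cube k)
slice b L = map tail (filter (admits? b ∘ head) L)

sizes : ∀ {k} → List (Cube k) → ℕ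
sizes L = sum (map size L)

sizes-slice : ∀ {k} (L : List (Cube (suc k))) → sizes L ≡ sizes (slice 0F L) + sizes (slice 1F L)
sizes-slice []      = refl
sizes-slice (c ∷ L) rewrite sizes-slice L with c zero
... | nothing          = e₀ (size (tail c)) (sizes (slice 0F L)) (sizes (slice 1F L))
  where
  e₀ : ∀ s A B → 2 * s + (A + B) ≡ s + A + (s + B)
  e₀ = solve-∀
... | just 0F          = e₁ (size (tail c)) (sizes (slice 0F L)) (sizes (slice 1F L))
  where
  e₁ : ∀ s A B → 1 * s + (A + B) ≡ s + A + B
  e₁ = solve-∀
... | just 1F          = e₂ (size (tail c)) (sizes (slice 0F L)) (sizes (slice 1F L))
  where
  e₂ : ∀ s A B → 1 * s + (A + B) ≡ A + (s + B)
  e₂ = solve-∀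

slice-all : ∀ {k b} {c : Cube (suc k)} (L : List (Cube (suc k))) → Admits b (head c) →
            All (Disjoint c) L → All (Disjoint (tail c)) (slice b L)
slice-all             []      _  []              = []
slice-all {b = b} {c} (d ∷ L) ac (c#d ∷ c#L) with admits? b (head d)
... | yes ad = tail-disjoint c#d ∷ slice-all L ac c#L
  where
  tail-disjoint : Disjoint c d → Disjoint (tail c) (tail d)
  tail-disjoint (zero  , clash) = ⊥-elim (admits-¬clash ac ad clash)
  tail-disjoint (suc i , clash) = i , clash
... | no _  = slice-all L ac c#L

slice-pairwise : ∀ {k} b (L : List (Cube (suc k))) →
                 AllPairs Disjoint L → AllPairs Disjoint (slice b L)
slice-pairwise b []      []            = []
slice-pairwise b (c ∷ L) (c#L ∷ L#) with admits? b (head c)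
... | yes ac = slice-all L ac c#L ∷ slice-pairwise b L L#
... | no _   = slice-pairwise b L L#

kraft : ∀ {k} (L : List (Cube k)) → AllPairs Disjoint L → sizes L ≤ 2 ^ k
kraft {zero}  []          _                     = z≤n
kraft {zero}  (c ∷ [])    _                     = ≤-refl
kraft {zero}  (c ∷ d ∷ L) (((() , _) ∷ _) ∷ _)
kraft {suc k} L L# = begin
  sizes L                                         ≡⟨ sizes-slice L ⟩
  sizes (slice 0F L) + sizes (slice 1F L) ≤⟨ +-mono-≤ (kraft _ (slice-pairwise 0F L L#))
                                                                (kraft _ (slice-pairwise 1F L L#)) ⟩
  2 ^ k + 2 ^ k                                   ≡⟨ cong (2 ^ k +_) (+-identityʳ (2 ^ k)) ⟨
  2 ^ suc k                                       ∎
  where open ≤-Reasoning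

codims : ∀ {k} → List (Cube k) → ℕ
codims L = sum (map codim L)

product-sizes : ∀ {k} (L : List (Cube k)) → product (map size L) * 2 ^ codims L ≡ (2 ^ k) ^ length L
product-sizes []      = refl
product-sizes {k} (c ∷ L) = begin
  size c * P * 2 ^ (codim c + codims L)      ≡⟨ cong (size c * P *_) (^-distribˡ-+-* 2 (codim c) _) ⟩
  size c * P * (2 ^ codim c * 2 ^ codims L)  ≡⟨ [m*n]*[o*p]≡[m*o]*[n*p] (size c) P _ _ ⟩
  size c * 2 ^ codim c * (P * 2 ^ codims L)  ≡⟨ cong₂ _*_ (size*2^codim≡2^k c) (product-sizes L) ⟩
  2 ^ k * (2 ^ k) ^ length L                 ∎
  where
  open ≡-Reasoning
  P : ℕ
  P = product (map size L)

-- tᵗ Π size ≤ (Σ size)ᵗ ≤ (2ᵏ)ᵗ = Π size · 2^codims, by AM–GM and Kraft's inequality.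
nⁿ≤2^codims : ∀ {k} (L : List (Cube k)) → AllPairs Disjoint L →
              length L ^ length L ≤ 2 ^ codims L
nⁿ≤2^codims {k} L L# = *-cancelˡ-≤ ((2 ^ k) ^ t) {{m^n≢0 (2 ^ k) t {{m^n≢0 2 k}}}} (begin
  (2 ^ k) ^ t * t ^ t              ≡⟨ *-comm ((2 ^ k) ^ t) (t ^ t) ⟩
  t ^ t * (2 ^ k) ^ t              ≡⟨ cong (t ^ t *_) (product-sizes L) ⟨
  t ^ t * (P * 2 ^ codims L)       ≡⟨ *-assoc (t ^ t) P _ ⟨
  t ^ t * P * 2 ^ codims L         ≤⟨ *-monoˡ-≤ (2 ^ codims L) amgm-sizes ⟩
  sizes L ^ t * 2 ^ codims L       ≤⟨ *-monoˡ-≤ (2 ^ codims L) (^-monoˡ-≤ t (kraft L L#)) ⟩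
  (2 ^ k) ^ t * 2 ^ codims L       ∎)
  where
  open ≤-Reasoning
  t P : ℕ
  t = length L
  P = product (map size L)
  amgm-sizes : t ^ t * P ≤ sizes L ^ t
  amgm-sizes = subst (λ n → n ^ n * P ≤ sizes L ^ n) (length-map size L) (amgm (map size L))

insert : ∀ {k} → Cube k → List (Cube k) → List (Cube k)
insert c []      = c ∷ []
insert c (d ∷ D) with disjoint? c d
... | yes _ = d ∷ insert c D
... | no _  = insert (c ∩ d) D

All-insert : ∀ {k} {P : Cube k → Set} c D →
             (∀ {e} → e ⊆ c → P e) → All P D → All P (insert c D)
All-insert c []      P⊆c []          = P⊆c ⊆-refl ∷ []
All-insert c (d ∷ D) P⊆c (Pd ∷ PD) with disjoint? c d
... | yes _ = Pd ∷ All-insert c D P⊆c PD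
... | no _  = All-insert (c ∩ d) D (λ e⊆c∩d → P⊆c (⊆-trans e⊆c∩d (∩-⊆ˡ c d))) PD

insert-pairwise : ∀ {k} c (D : List (Cube k)) → AllPairs Disjoint D → AllPairs Disjoint (insert c D)
insert-pairwise c []      []           = [] ∷ []
insert-pairwise c (d ∷ D) (d#D ∷ D#) with disjoint? c d
... | yes c#d = All-insert c D (Disjoint-⊆ʳ (Disjoint-sym c#d)) d#D ∷ insert-pairwise c D D#
... | no _    = insert-pairwise (c ∩ d) D D#

codims-insert : ∀ {k} c (D : List (Cube k)) → codims (insert c D) ≤ codim c + codims D
codims-insert c []      = ≤-refl
codims-insert c (d ∷ D) with disjoint? c d
... | yes _ = begin
  codim d + codims (insert c D)  ≤⟨ +-monoʳ-≤ (codim d) (codims-insert c D) ⟩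
  codim d + (codim c + codims D) ≡⟨ e (codim d) (codim c) (codims D) ⟩
  codim c + (codim d + codims D) ∎
  where
  open ≤-Reasoning
  e : ∀ x y z → x + (y + z) ≡ y + (x + z)
  e = solve-∀
... | no _  = begin
  codims (insert (c ∩ d) D)      ≤⟨ codims-insert (c ∩ d) D ⟩
  codim (c ∩ d) + codims D       ≤⟨ +-monoˡ-≤ (codims D) (codim-∩ c d) ⟩
  codim c + codim d + codims D   ≡⟨ +-assoc (codim c) (codim d) (codims D) ⟩
  codim c + (codim d + codims D) ∎
  where open ≤-Reasoning

insert-⊆ : ∀ {k} c (D : List (Cube k)) → Any (_⊆ c) (insert c D)
insert-⊆ c []      = here ⊆-refl
insert-⊆ c (d ∷ D) with disjoint? c d
... | yes _ = there (insert-⊆ c D)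
... | no _  = Any.map (λ e⊆c∩d → ⊆-trans e⊆c∩d (∩-⊆ˡ c d)) (insert-⊆ (c ∩ d) D)

insert-refines : ∀ {k} {S : Cube k} c D → Any (_⊆ S) D → Any (_⊆ S) (insert c D)
insert-refines c (d ∷ D) S⊇D with disjoint? c d
insert-refines c (d ∷ D) (here d⊆S)  | yes _   = here d⊆S
insert-refines c (d ∷ D) (there e⊆S) | yes _   = there (insert-refines c D e⊆S)
insert-refines c (d ∷ D) (here d⊆S)  | no ¬c#d =
  Any.map (λ e⊆c∩d → ⊆-trans e⊆c∩d (⊆-trans (∩-⊆ʳ ¬c#d) d⊆S)) (insert-⊆ (c ∩ d) D)
insert-refines c (d ∷ D) (there e⊆S) | no _    = insert-refines (c ∩ d) D e⊆S

disjointify : ∀ {k} → List (Cube k) → List (Cube k)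
disjointify = foldr insert []

disjointify-pairwise : ∀ {k} (L : List (Cube k)) → AllPairs Disjoint (disjointify L)
disjointify-pairwise []      = []
disjointify-pairwise (c ∷ L) = insert-pairwise c (disjointify L) (disjointify-pairwise L)

codims-disjointify : ∀ {k} (L : List (Cube k)) → codims (disjointify L) ≤ codims L
codims-disjointify []      = ≤-refl
codims-disjointify (c ∷ L) =
  ≤-trans (codims-insert c (disjointify L)) (+-monoʳ-≤ (codim c) (codims-disjointify L))

disjointify-refines : ∀ {k} (L : List (Cube k)) → All (λ c → Any (_⊆ c) (disjointify L)) L
disjointify-refines []      = []
disjointify-refines (c ∷ L) =
  insert-⊆ c (disjointify L) ∷ All.map (insert-refines c (disjointify L)) (disjointify-refines L)

Disjoint⇒¬⊆both : ∀ {k} {c d e : Cube k} → Disjoint c d → e ⊆ c → ¬ e ⊆ d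
Disjoint⇒¬⊆both c#d e⊆c e⊆d =
  Disjoint-irrefl (Disjoint-⊆ʳ (Disjoint-sym (Disjoint-⊆ʳ c#d e⊆d)) e⊆c)

cubes-coloring : ∀ {n k} (G : Graph n) (cube : Fin n → Cube k) (D : List (Cube k)) →
                 (∀ u v → Adj G u v → Disjoint (cube u) (cube v)) →
                 (∀ v → Any (_⊆ cube v) D) →
                 Colorable G (length D)
cubes-coloring {n} G cube D edge-disjoint below = colour , proper
  where
  colour : Fin n → Fin (length D)
  colour v = Any.index (below v)
  proper : IsColoring G (length D) colour
  proper u v uv u≡v = Disjoint⇒¬⊆both (edge-disjoint u v uv) (lookup-index (below u))
    (subst (λ j → lookup D j ⊆ cube v) (sym u≡v) (lookup-index (below v)))

colorable-mono : ∀ {n s t} {G : Graph n} → s ≤ t → Colorable G s → Colorable G t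
colorable-mono s≤t (colour , proper) =
  (λ v → inject≤ (colour v) s≤t) , λ u v uv eq → proper u v uv (inject≤-injective s≤t s≤t _ _ eq)

vertexCube : ∀ {n k} → (Fin k → Subset n) → (Fin k → Fin n → Fin 2) → Fin n → Cube k
vertexCube V col v i = if Vec.lookup (V i) v then just (col i v) else nothing

vertexCube-∈ : ∀ {n k} (V : Fin k → Subset n) col {v i} →
               v ∈ V i → vertexCube V col v i ≡ just (col i v)
vertexCube-∈ V col v∈Vᵢ rewrite []=⇒lookup v∈Vᵢ = refl

sum-tabulate : ∀ {n} (f : Fin n → ℕ) → sum (tabulate f) ≡ ∑[ i < n ] f i
sum-tabulate {zero}  f = refl
sum-tabulate {suc n} f = cong (f zero +_) (sum-tabulate (f ∘ suc))

∑-fixed-if : ∀ {n} (p : Subset n) (f : Fin n → Fin 2) →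
             ∑[ v < n ] fixed (if Vec.lookup p v then just (f v) else nothing) ≡ ∣ p ∣
∑-fixed-if Vec.[]          f = refl
∑-fixed-if (true Vec.∷ p)  f = cong suc (∑-fixed-if p (f ∘ suc))
∑-fixed-if (false Vec.∷ p) f = ∑-fixed-if p (f ∘ suc)

codims-vertexCubes : ∀ {n k} (V : Fin k → Subset n) col →
                     codims (tabulate (vertexCube V col)) ≡ ∑[ i < k ] ∣ V i ∣
codims-vertexCubes {n} {k} V col = begin
  sum (map codim (tabulate cube))           ≡⟨ cong sum (map-tabulate cube codim) ⟩
  sum (tabulate (codim ∘ cube))             ≡⟨ sum-tabulate (codim ∘ cube) ⟩
  ∑[ v < n ] ∑[ i < k ] fixed (cube v i)    ≡⟨ ∑-comm (λ v i → fixed (cube v i)) ⟩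
  ∑[ i < k ] ∑[ v < n ] fixed (cube v i)    ≡⟨ sum-cong-≗ (λ i → ∑-fixed-if (V i) (col i)) ⟩
  ∑[ i < k ] ∣ V i ∣                        ∎
  where
  open ≡-Reasoning
  cube : Fin n → Cube k
  cube = vertexCube V col

cap≡∑ : ∀ {n} k (Gs : Fin k → SubGraph n) → cap k Gs ≡ ∑[ i < k ] ∣ verts (Gs i) ∣
cap≡∑ zero    Gs = refl
cap≡∑ (suc k) Gs = cong (∣ verts (Gs zero) ∣ +_) (cap≡∑ k (Gs ∘ suc))

union-edges-disjoint : ∀ {n k} {G : Graph n} (Gs : Fin k → SubGraph n) (col : Fin k → Fin n → Fin 2) →
                       (∀ i → IsColoring (graph (Gs i)) 2 (col i)) → IsUnion G Gs →
                       let cube = vertexCube (verts ∘ Gs) col in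
                       ∀ u v → Adj G u v → Disjoint (cube u) (cube v)
union-edges-disjoint Gs col proper G≡⋃Gs u v uv with proj₁ (G≡⋃Gs u v) uv
... | i , uvᵢ with inVerts (Gs i) uvᵢ
...   | u∈Vᵢ , v∈Vᵢ = i , subst₂ Clash (sym (at u∈Vᵢ)) (sym (at v∈Vᵢ)) (proper i u v uvᵢ)
  where
  at : ∀ {v i} → v ∈ verts (Gs i) → vertexCube (verts ∘ Gs) col v i ≡ just (col i v)
  at = vertexCube-∈ (verts ∘ Gs) col

lemma8p4 : (n m k : ℕ) (G : Graph n) (Gs : Fin k → SubGraph n) →
           ¬ Colorable G m →
           (∀ i → Bipartite (Gs i)) →
           IsUnion G Gs →
           suc m ^ suc m ≤ 2 ^ cap k Gs
lemma8p4 n m k G Gs ¬colorable bipartite G≡⋃Gs = begin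
  suc m ^ suc m  ≤⟨ m≤n⇒mᵐ≤nⁿ m<t ⟩
  t ^ t          ≤⟨ nⁿ≤2^codims D (disjointify-pairwise L) ⟩
  2 ^ codims D   ≤⟨ ^-monoʳ-≤ 2 (codims-disjointify L) ⟩
  2 ^ codims L   ≡⟨ cong (2 ^_) (trans (codims-vertexCubes (verts ∘ Gs) col) (sym (cap≡∑ k Gs))) ⟩
  2 ^ cap k Gs   ∎
  where
  open ≤-Reasoning
  col : Fin k → Fin n → Fin 2
  col i = proj₁ (bipartite i)
  L D : List (Cube k)
  L = tabulate (vertexCube (verts ∘ Gs) col)
  D = disjointify L
  t : ℕ
  t = length D
  D-coloring : Colorable G t
  D-coloring = cubes-coloring G (vertexCube (verts ∘ Gs) col) D
    (union-edges-disjoint {G = G} Gs col (λ i → proj₂ (bipartite i)) G≡⋃Gs)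
    (tabulate⁻ (disjointify-refines L))
  m<t : m < t
  m<t = ≰⇒> λ t≤m → ¬colorable (colorable-mono {G = G} t≤m D-coloring)
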